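{- For each integer $n \geq 829$, put $f(n)=\left[ \left(\sum_{k=n}^{\infty}\frac{1}{k^6} \right)^{ -1} \right]$, and let $n_{48}$ denote the remainder when $n$ is divided by $48$ (so $0\le n_{48}\le 47$). Then \begin{equation*} f(n)=\begin{cases} 5n^5 - \frac{25}{2} n^4 +\frac{75}{4} n^3 -\frac{125}{8} n^2 +\frac{185}{48}n - \frac{5 n_{48}}{48} - \left[\frac{35-5 n_{48}}{48}\right], & \text{if } n \text{ is even}; \\ 5n^5 - \frac{25}{2} n^4 +\frac{75}{4} n^3 -\frac{125}{8} n^2 +\frac{185}{48}n - \frac{5 n_{48}+18}{48} - \left[\frac{17-5 n_{48}}{48}\right], & \text{if } n \text{ is odd}. \end{cases} \end{equation*}
   Context: For a real number $x$, $[x]$ denotes the greatest integer less than or equal to $x$. -}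

module Defs where

open import Data.Nat as ℕ using (ℕ; zero; suc; _%_)
open import Data.Integer as ℤ using (ℤ; +_)
open import Data.Rational using (ℚ; _/_; _+_; _-_; _*_; _≤_; _<_; floor; 0ℚ; 1ℚ)
open import Data.Product using (Σ; _×_)

-- 1 / k^6 as a rational (k = 0 never occurs below; it is given value 0)
recip6 : ℕ → ℚ
recip6 zero    = 0ℚ
recip6 (suc j) = (+ 1) / (suc j ℕ.^ 6)

tailPartial : ℕ → ℕ → ℚ
tailPartial n zero    = recip6 n
tailPartial n (suc N) = tailPartial n N + recip6 (n ℕ.+ suc N)

fromℤ : ℤ → ℚ
fromℤ z = z / 1

-- "m = [ (Σ_{k=n}^∞ 1/k^6)^{-1} ]", i.e. with S the (real) tail sum,
-- m ≤ 1/S < m+1, equivalently  m·S ≤ 1  and  (m+1)·S > 1  (S > 0).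
-- Since the partial sums increase to S:
--   m·S ≤ 1      iff  every partial sum satisfies m·s_N ≤ 1,
--   (m+1)·S > 1  iff  some partial sum satisfies (m+1)·s_N > 1.
IsFloorRecipTail : ℕ → ℤ → Set
IsFloorRecipTail n m =
  ((N : ℕ) → fromℤ m * tailPartial n N ≤ 1ℚ) ×
  Σ ℕ (λ N → 1ℚ < (fromℤ m + 1ℚ) * tailPartial n N)

nq : ℕ → ℚ
nq k = (+ k) / 1

polyPart : ℕ → ℚ
polyPart n =
  ((+ 5) / 1) * nq (n ℕ.^ 5) - ((+ 25) / 2) * nq (n ℕ.^ 4)
  + ((+ 75) / 4) * nq (n ℕ.^ 3) - ((+ 125) / 8) * nq (n ℕ.^ 2)
  + ((+ 185) / 48) * nq n

n48 : ℕ → ℕ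
n48 n = n % 48

formulaEven : ℕ → ℚ
formulaEven n =
  polyPart n - ((+ (5 ℕ.* n48 n)) / 48)
  - fromℤ (floor ((+ 35 ℤ.- + (5 ℕ.* n48 n)) / 48))

formulaOdd : ℕ → ℚ
formulaOdd n =
  polyPart n - ((+ (5 ℕ.* n48 n ℕ.+ 18)) / 48)
  - fromℤ (floor ((+ 17 ℤ.- + (5 ℕ.* n48 n)) / 48))

-- Telescoping against truncations of the midpoint Euler–Maclaurin series of Σ_{j≥k} j⁻⁶
-- gives, for n ≥ 829 and S any partial tail sum (with at least n³ terms for the lower bound),
--   48 / (P(n) + 13) < S ≤ 48 / (P(n) + 12),   P(n) = 48 · polyPart n
--                                                  = 240n⁵ − 600n⁴ + 900n³ − 750n² + 185n.
-- Hence ⌊1/S⌋ = m for every integer m with P(n) + 13 − 48 ≤ 48m ≤ P(n) + 12, i.e. for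
-- m = (P(n) − c)/48 whenever c ≡ P(n) (mod 48) and −12 ≤ c ≤ 35.  Since P(n) mod 48 depends
-- only on n mod 48, the paper's correction term supplies such a c, as 48 evaluations confirm.
-- Every polynomial inequality for n ≥ 829 is certified by computation: after substituting
-- n = 829 + t its coefficients are all nonnegative.
module Submission where

open import Defs

module Polynomial where

  open import Data.Nat as ℕ using (ℕ; zero; suc)
  import Data.Nat.Properties as ℕ
  open import Data.Integer using (ℤ; +_; 0ℤ; 1ℤ; -1ℤ; _+_; _-_; _*_; _^_; _≤_; _<_; _≤?_)
  import Data.Integer.Properties as ℤ
  open import Relation.Nullary using (Dec)
  open import Data.Integer.Divisibility.Signed using (_∣_; divides; ∣m∣n⇒∣m+n; ∣n⇒∣m*n; ∣m⇒∣m*n)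
  open import Data.Integer.Tactic.RingSolver using (solve-∀)
  open import Data.List using (List; []; _∷_; map)
  open import Data.List.Relation.Unary.All using (All; []; _∷_; all?)
  open import Relation.Nullary.Decidable using (True; toWitness)
  open import Relation.Binary.PropositionalEquality
  open ≡-Reasoning

  Poly : Set
  Poly = List ℤ

  ⟦_⟧ : Poly → ℤ → ℤ
  ⟦ [] ⟧    x = 0ℤ
  ⟦ c ∷ p ⟧ x = c + x * ⟦ p ⟧ x

  infixl 6 _+ₚ_ _-ₚ_
  infixl 7 _*ₚ_ _·ₚ_
  infixr 8 _^ₚ_
  infixr 9 _∘ₚ_

  constₚ : ℤ → Poly
  constₚ c = c ∷ []

  xₚ : Poly
  xₚ = 0ℤ ∷ 1ℤ ∷ []

  _+ₚ_ : Poly → Poly → Poly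
  []      +ₚ q       = q
  (a ∷ p) +ₚ []      = a ∷ p
  (a ∷ p) +ₚ (b ∷ q) = a + b ∷ p +ₚ q

  _·ₚ_ : ℤ → Poly → Poly
  c ·ₚ p = map (c *_) p

  _-ₚ_ : Poly → Poly → Poly
  p -ₚ q = p +ₚ -1ℤ ·ₚ q

  _*ₚ_ : Poly → Poly → Poly
  []      *ₚ q = []
  (a ∷ p) *ₚ q = a ·ₚ q +ₚ (0ℤ ∷ p *ₚ q)

  _^ₚ_ : Poly → ℕ → Poly
  p ^ₚ zero  = constₚ 1ℤ
  p ^ₚ suc n = p *ₚ p ^ₚ n

  _∘ₚ_ : Poly → Poly → Poly
  []      ∘ₚ q = []
  (a ∷ p) ∘ₚ q = constₚ a +ₚ q *ₚ (p ∘ₚ q)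

  eval-const : ∀ c x → ⟦ constₚ c ⟧ x ≡ c
  eval-const c x = trans (cong (λ v → c + v) (ℤ.*-zeroʳ x)) (ℤ.+-identityʳ c)

  eval-x : ∀ x → ⟦ xₚ ⟧ x ≡ x
  eval-x x = trans (ℤ.+-identityˡ _) (trans (cong (x *_) (eval-const 1ℤ x)) (ℤ.*-identityʳ x))

  eval-+ : ∀ p q x → ⟦ p +ₚ q ⟧ x ≡ ⟦ p ⟧ x + ⟦ q ⟧ x
  eval-+ []      q       x = sym (ℤ.+-identityˡ _)
  eval-+ (a ∷ p) []      x = sym (ℤ.+-identityʳ _)
  eval-+ (a ∷ p) (b ∷ q) x = begin
    a + b + x * ⟦ p +ₚ q ⟧ x            ≡⟨ cong (λ v → a + b + x * v) (eval-+ p q x) ⟩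
    a + b + x * (⟦ p ⟧ x + ⟦ q ⟧ x)     ≡⟨ lemma a b x (⟦ p ⟧ x) (⟦ q ⟧ x) ⟩
    a + x * ⟦ p ⟧ x + (b + x * ⟦ q ⟧ x) ∎
    where
    lemma : ∀ a b x u v → a + b + x * (u + v) ≡ a + x * u + (b + x * v)
    lemma = solve-∀

  eval-· : ∀ c p x → ⟦ c ·ₚ p ⟧ x ≡ c * ⟦ p ⟧ x
  eval-· c []      x = sym (ℤ.*-zeroʳ c)
  eval-· c (a ∷ p) x = begin
    c * a + x * ⟦ c ·ₚ p ⟧ x ≡⟨ cong (λ v → c * a + x * v) (eval-· c p x) ⟩
    c * a + x * (c * ⟦ p ⟧ x) ≡⟨ lemma c a x (⟦ p ⟧ x) ⟩
    c * (a + x * ⟦ p ⟧ x)     ∎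
    where
    lemma : ∀ c a x u → c * a + x * (c * u) ≡ c * (a + x * u)
    lemma = solve-∀

  eval-sub : ∀ p q x → ⟦ p -ₚ q ⟧ x ≡ ⟦ p ⟧ x - ⟦ q ⟧ x
  eval-sub p q x = begin
    ⟦ p +ₚ -1ℤ ·ₚ q ⟧ x          ≡⟨ eval-+ p (-1ℤ ·ₚ q) x ⟩
    ⟦ p ⟧ x + ⟦ -1ℤ ·ₚ q ⟧ x     ≡⟨ cong (λ v → ⟦ p ⟧ x + v) (eval-· -1ℤ q x) ⟩
    ⟦ p ⟧ x + -1ℤ * ⟦ q ⟧ x      ≡⟨ cong (λ v → ⟦ p ⟧ x + v) (ℤ.-1*i≡-i (⟦ q ⟧ x)) ⟩
    ⟦ p ⟧ x - ⟦ q ⟧ x            ∎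

  eval-* : ∀ p q x → ⟦ p *ₚ q ⟧ x ≡ ⟦ p ⟧ x * ⟦ q ⟧ x
  eval-* []      q x = refl
  eval-* (a ∷ p) q x = begin
    ⟦ a ·ₚ q +ₚ (0ℤ ∷ p *ₚ q) ⟧ x                  ≡⟨ eval-+ (a ·ₚ q) (0ℤ ∷ p *ₚ q) x ⟩
    ⟦ a ·ₚ q ⟧ x + (0ℤ + x * ⟦ p *ₚ q ⟧ x)          ≡⟨ cong₂ (λ u v → u + (0ℤ + x * v))
                                                          (eval-· a q x) (eval-* p q x) ⟩
    a * ⟦ q ⟧ x + (0ℤ + x * (⟦ p ⟧ x * ⟦ q ⟧ x))   ≡⟨ lemma a x (⟦ p ⟧ x) (⟦ q ⟧ x) ⟩
    (a + x * ⟦ p ⟧ x) * ⟦ q ⟧ x                     ∎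
    where
    lemma : ∀ a x u v → a * v + (0ℤ + x * (u * v)) ≡ (a + x * u) * v
    lemma = solve-∀

  eval-^ : ∀ p n x → ⟦ p ^ₚ n ⟧ x ≡ ⟦ p ⟧ x ^ n
  eval-^ p zero    x = eval-const 1ℤ x
  eval-^ p (suc n) x = trans (eval-* p (p ^ₚ n) x) (cong (⟦ p ⟧ x *_) (eval-^ p n x))

  eval-∘ : ∀ p q x → ⟦ p ∘ₚ q ⟧ x ≡ ⟦ p ⟧ (⟦ q ⟧ x)
  eval-∘ []      q x = refl
  eval-∘ (a ∷ p) q x = begin
    ⟦ constₚ a +ₚ q *ₚ (p ∘ₚ q) ⟧ x             ≡⟨ eval-+ (constₚ a) (q *ₚ (p ∘ₚ q)) x ⟩
    ⟦ constₚ a ⟧ x + ⟦ q *ₚ (p ∘ₚ q) ⟧ x       ≡⟨ cong₂ _+_ (eval-const a x) (eval-* q (p ∘ₚ q) x) ⟩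
    a + ⟦ q ⟧ x * ⟦ p ∘ₚ q ⟧ x                 ≡⟨ cong (λ v → a + ⟦ q ⟧ x * v) (eval-∘ p q x) ⟩
    a + ⟦ q ⟧ x * ⟦ p ⟧ (⟦ q ⟧ x)              ∎

  pos-^ : ∀ m n → + (m ℕ.^ n) ≡ (+ m) ^ n
  pos-^ m zero    = refl
  pos-^ m (suc n) = trans (ℤ.pos-* m (m ℕ.^ n)) (cong ((+ m) *_) (pos-^ m n))

  eval-x^ : ∀ n k → ⟦ xₚ ^ₚ n ⟧ (+ k) ≡ + (k ℕ.^ n)
  eval-x^ n k = trans (eval-^ xₚ n (+ k)) (trans (cong (_^ n) (eval-x (+ k))) (sym (pos-^ k n)))

  eval-shift : ∀ a t → ⟦ constₚ (+ a) +ₚ xₚ ⟧ (+ t) ≡ + (a ℕ.+ t)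
  eval-shift a t = begin
    ⟦ constₚ (+ a) +ₚ xₚ ⟧ (+ t)           ≡⟨ eval-+ (constₚ (+ a)) xₚ (+ t) ⟩
    ⟦ constₚ (+ a) ⟧ (+ t) + ⟦ xₚ ⟧ (+ t)  ≡⟨ cong₂ _+_ (eval-const (+ a) (+ t)) (eval-x (+ t)) ⟩
    + a + + t                              ≡⟨ ℤ.pos-+ a t ⟨
    + (a ℕ.+ t)                            ∎

  eval-∣ : ∀ {d} p x y → d ∣ x - y → d ∣ ⟦ p ⟧ x - ⟦ p ⟧ y
  eval-∣ {d} []      x y _     = divides 0ℤ (sym (ℤ.*-zeroˡ d))
  eval-∣ {d} (c ∷ p) x y d∣x-y = subst (d ∣_) (lemma c x y (⟦ p ⟧ x) (⟦ p ⟧ y))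
    (∣m∣n⇒∣m+n (∣n⇒∣m*n x (eval-∣ p x y d∣x-y)) (∣m⇒∣m*n (⟦ p ⟧ y) d∣x-y))
    where
    lemma : ∀ c x y u v → x * (u - v) + (x - y) * v ≡ c + x * u - (c + y * v)
    lemma = solve-∀

  nonNegCoeffs⇒nonNeg : ∀ {p} → All (0ℤ ≤_) p → ∀ k → 0ℤ ≤ ⟦ p ⟧ (+ k)
  nonNegCoeffs⇒nonNeg []            k = ℤ.≤-refl
  nonNegCoeffs⇒nonNeg {c ∷ p} (c≥0 ∷ p≥0) k = ℤ.+-mono-≤ c≥0 (subst (_≤ + k * ⟦ p ⟧ (+ k))
    (ℤ.*-zeroʳ (+ k)) (ℤ.*-monoˡ-≤-nonNeg (+ k) (nonNegCoeffs⇒nonNeg p≥0 k)))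

  NonNegFrom : ℕ → Poly → Set
  NonNegFrom x₀ p = All (0ℤ ≤_) (p ∘ₚ (constₚ (+ x₀) +ₚ xₚ))

  nonNegFrom? : ∀ x₀ p → Dec (NonNegFrom x₀ p)
  nonNegFrom? x₀ p = all? (0ℤ ≤?_) _

  nonNegFrom⇒nonNeg : ∀ {x₀} p → NonNegFrom x₀ p → ∀ {k} → x₀ ℕ.≤ k → 0ℤ ≤ ⟦ p ⟧ (+ k)
  nonNegFrom⇒nonNeg {x₀} p p≥0 {k} x₀≤k = subst (0ℤ ≤_) shifted (nonNegCoeffs⇒nonNeg p≥0 (k ℕ.∸ x₀))
    where
    shifted : ⟦ p ∘ₚ (constₚ (+ x₀) +ₚ xₚ) ⟧ (+ (k ℕ.∸ x₀)) ≡ ⟦ p ⟧ (+ k)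
    shifted = trans (eval-∘ p _ _) (cong ⟦ p ⟧ (trans (eval-shift x₀ _) (cong +_ (ℕ.m+[n∸m]≡n x₀≤k))))

  ≤-from : ∀ x₀ p q → NonNegFrom x₀ (q -ₚ p) → ∀ {k} → x₀ ℕ.≤ k → ⟦ p ⟧ (+ k) ≤ ⟦ q ⟧ (+ k)
  ≤-from x₀ p q q-p≥0 x₀≤k =
    ℤ.0≤i-j⇒j≤i (subst (0ℤ ≤_) (eval-sub q p _) (nonNegFrom⇒nonNeg (q -ₚ p) q-p≥0 x₀≤k))

  <-from : ∀ x₀ p q → NonNegFrom x₀ (q -ₚ (constₚ 1ℤ +ₚ p)) →
           ∀ {k} → x₀ ℕ.≤ k → ⟦ p ⟧ (+ k) < ⟦ q ⟧ (+ k)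
  <-from x₀ p q q-1-p≥0 {k} x₀≤k = ℤ.suc[i]≤j⇒i<j (subst (_≤ ⟦ q ⟧ (+ k))
    (trans (eval-+ (constₚ 1ℤ) p (+ k)) (cong (_+ ⟦ p ⟧ (+ k)) (eval-const 1ℤ (+ k))))
    (≤-from x₀ (constₚ 1ℤ +ₚ p) q q-1-p≥0 x₀≤k))

  pos-from : ∀ x₀ q {k} → {_ : True (nonNegFrom? x₀ (q -ₚ constₚ 1ℤ))} → x₀ ℕ.≤ k → 0ℤ < ⟦ q ⟧ (+ k)
  pos-from x₀ q {k} {cert} x₀≤k = ℤ.suc[i]≤j⇒i<j
    (subst (_≤ ⟦ q ⟧ (+ k)) (eval-const 1ℤ (+ k)) (≤-from x₀ (constₚ 1ℤ) q (toWitness cert) x₀≤k))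

  zeroCoeffs⇒zero : ∀ {p} → All (_≡ 0ℤ) p → ∀ x → ⟦ p ⟧ x ≡ 0ℤ
  zeroCoeffs⇒zero []            x = refl
  zeroCoeffs⇒zero (refl ∷ p≡0) x =
    trans (ℤ.+-identityˡ _) (trans (cong (x *_) (zeroCoeffs⇒zero p≡0 x)) (ℤ.*-zeroʳ x))

  ≡-everywhere : ∀ p q → All (_≡ 0ℤ) (q -ₚ p) → ∀ x → ⟦ p ⟧ x ≡ ⟦ q ⟧ x
  ≡-everywhere p q q-p≡0 x = sym (ℤ.i-j≡0⇒i≡j _ _ (trans (sym (eval-sub q p x)) (zeroCoeffs⇒zero q-p≡0 x)))

module Fraction where

  open import Data.Nat as ℕ using (suc)
  open import Data.Integer as ℤ using (ℤ; +_)
  import Data.Integer.Properties as ℤ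
  open import Data.Rational using (ℚ; toℚᵘ; _/_; _+_; _-_; _*_; -_; _≤_; _<_)
  open import Data.Rational.Properties
    using ( toℚᵘ-homo-+; toℚᵘ-homo-*; toℚᵘ-homo‿-; toℚᵘ-fromℚᵘ; toℚᵘ-injective
          ; toℚᵘ-cancel-≤; toℚᵘ-cancel-<)
  open import Data.Rational.Unnormalised as ℚᵘ using (mkℚᵘ; *≡*; *≤*; *<*)
  import Data.Rational.Unnormalised.Properties as ℚᵘ
  open import Relation.Binary.PropositionalEquality

  -- x = a / b; indexing by b = + suc d builds the positivity of the denominator in.
  data Frac (x : ℚ) (a : ℤ) : ℤ → Set where
    frac : ∀ d → toℚᵘ x ℚᵘ.≃ mkℚᵘ a d → Frac x a (+ suc d)

  Frac-cong : ∀ {x a a′ b b′} → a ≡ a′ → b ≡ b′ → Frac x a b → Frac x a′ b′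
  Frac-cong refl refl f = f

  Frac-/ : ∀ a n .{{_ : ℕ.NonZero n}} → Frac (a / n) a (+ n)
  Frac-/ a (suc n) = frac n (toℚᵘ-fromℚᵘ (mkℚᵘ a n))

  Frac-+ : ∀ {x y a b c d} → Frac x a b → Frac y c d → Frac (x + y) (a ℤ.* d ℤ.+ c ℤ.* b) (b ℤ.* d)
  Frac-+ {x} {y} (frac b ex) (frac d ey) =
    frac (d ℕ.+ b ℕ.* suc d) (ℚᵘ.≃-trans (toℚᵘ-homo-+ x y) (ℚᵘ.+-cong ex ey))

  Frac-* : ∀ {x y a b c d} → Frac x a b → Frac y c d → Frac (x * y) (a ℤ.* c) (b ℤ.* d)
  Frac-* {x} {y} (frac b ex) (frac d ey) =
    frac (d ℕ.+ b ℕ.* suc d) (ℚᵘ.≃-trans (toℚᵘ-homo-* x y) (ℚᵘ.*-cong ex ey))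

  Frac-neg : ∀ {x a b} → Frac x a b → Frac (- x) (ℤ.- a) b
  Frac-neg {x} (frac b ex) = frac b (ℚᵘ.≃-trans (toℚᵘ-homo‿- x) (ℚᵘ.-‿cong ex))

  Frac-sub : ∀ {x y a b c d} → Frac x a b → Frac y c d → Frac (x - y) (a ℤ.* d ℤ.- c ℤ.* b) (b ℤ.* d)
  Frac-sub {a = a} {b} {c} {d} fx fy =
    Frac-cong (cong (λ v → a ℤ.* d ℤ.+ v) (sym (ℤ.neg-distribˡ-* c b))) refl (Frac-+ fx (Frac-neg fy))

  Frac-≤ : ∀ {x y a b c d} → Frac x a b → Frac y c d → a ℤ.* d ℤ.≤ c ℤ.* b → x ≤ y
  Frac-≤ (frac _ ex) (frac _ ey) h =
    toℚᵘ-cancel-≤ (ℚᵘ.≤-respˡ-≃ (ℚᵘ.≃-sym ex) (ℚᵘ.≤-respʳ-≃ (ℚᵘ.≃-sym ey) (*≤* h)))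

  Frac-< : ∀ {x y a b c d} → Frac x a b → Frac y c d → a ℤ.* d ℤ.< c ℤ.* b → x < y
  Frac-< (frac _ ex) (frac _ ey) h =
    toℚᵘ-cancel-< (ℚᵘ.<-respˡ-≃ (ℚᵘ.≃-sym ex) (ℚᵘ.<-respʳ-≃ (ℚᵘ.≃-sym ey) (*<* h)))

  Frac-≡ : ∀ {x y a b c d} → Frac x a b → Frac y c d → a ℤ.* d ≡ c ℤ.* b → x ≡ y
  Frac-≡ (frac _ ex) (frac _ ey) h =
    toℚᵘ-injective (ℚᵘ.≃-trans ex (ℚᵘ.≃-trans (*≡* h) (ℚᵘ.≃-sym ey)))

module RationalFunction where

  open import Data.Nat as ℕ using (ℕ; zero; suc)
  open import Data.Integer as ℤ using (ℤ; +_; 0ℤ; 1ℤ)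
  open import Data.Rational using (ℚ; _/_; _+_; _-_; _*_; _≤_; _<_; 0ℚ)
  open import Data.List.Relation.Unary.All using (all?)
  open import Relation.Nullary.Decidable using (True; toWitness)
  open import Relation.Binary.PropositionalEquality
  open Polynomial
  open Fraction

  -- A record rather than a synonym, so that p and q can be inferred.
  record FracAt (x : ℚ) (p q : Poly) (k : ℤ) : Set where
    constructor fracAt
    field frac-at : Frac x (⟦ p ⟧ k) (⟦ q ⟧ k)
  open FracAt public

  FracAt-/ : ∀ p d {k} .{{_ : ℕ.NonZero d}} → FracAt (⟦ p ⟧ k / d) p (constₚ (+ d)) k
  FracAt-/ p d {k} = fracAt (Frac-cong refl (sym (eval-const (+ d) k)) (Frac-/ _ d))

  FracAt-const : ∀ a d {k} .{{_ : ℕ.NonZero d}} → FracAt (a / d) (constₚ a) (constₚ (+ d)) k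
  FracAt-const a d {k} =
    fracAt (Frac-cong (sym (eval-const a k)) (sym (eval-const (+ d) k)) (Frac-/ a d))

  module _ {x y : ℚ} {p q r s : Poly} {k : ℤ} where

    FracAt-+ : FracAt x p q k → FracAt y r s k → FracAt (x + y) (p *ₚ s +ₚ r *ₚ q) (q *ₚ s) k
    FracAt-+ (fracAt fx) (fracAt fy) = fracAt (Frac-cong
      (sym (trans (eval-+ (p *ₚ s) (r *ₚ q) k) (cong₂ ℤ._+_ (eval-* p s k) (eval-* r q k))))
      (sym (eval-* q s k)) (Frac-+ fx fy))

    FracAt-sub : FracAt x p q k → FracAt y r s k → FracAt (x - y) (p *ₚ s -ₚ r *ₚ q) (q *ₚ s) k
    FracAt-sub (fracAt fx) (fracAt fy) = fracAt (Frac-cong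
      (sym (trans (eval-sub (p *ₚ s) (r *ₚ q) k) (cong₂ ℤ._-_ (eval-* p s k) (eval-* r q k))))
      (sym (eval-* q s k)) (Frac-sub fx fy))

    FracAt-* : FracAt x p q k → FracAt y r s k → FracAt (x * y) (p *ₚ r) (q *ₚ s) k
    FracAt-* (fracAt fx) (fracAt fy) =
      fracAt (Frac-cong (sym (eval-* p r k)) (sym (eval-* q s k)) (Frac-* fx fy))

  FracAt-∘ : ∀ {x p q} t {k k′} → ⟦ t ⟧ k ≡ k′ → FracAt x p q k′ → FracAt x (p ∘ₚ t) (q ∘ₚ t) k
  FracAt-∘ {p = p} {q} t {k} refl (fracAt f) =
    fracAt (Frac-cong (sym (eval-∘ p t k)) (sym (eval-∘ q t k)) f)

  -- The implicit certificates are discharged by evaluation at concrete polynomials.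
  FracAt-≤ : ∀ {x y p q r s} x₀ {k} → FracAt x p q (+ k) → FracAt y r s (+ k) →
             {_ : True (nonNegFrom? x₀ (r *ₚ q -ₚ p *ₚ s))} → x₀ ℕ.≤ k → x ≤ y
  FracAt-≤ {p = p} {q} {r} {s} x₀ {k} (fracAt fx) (fracAt fy) {cert} x₀≤k =
    Frac-≤ fx fy (subst₂ ℤ._≤_ (eval-* p s (+ k)) (eval-* r q (+ k))
      (≤-from x₀ (p *ₚ s) (r *ₚ q) (toWitness cert) x₀≤k))

  FracAt-< : ∀ {x y p q r s} x₀ {k} → FracAt x p q (+ k) → FracAt y r s (+ k) →
             {_ : True (nonNegFrom? x₀ (r *ₚ q -ₚ (constₚ 1ℤ +ₚ p *ₚ s)))} → x₀ ℕ.≤ k → x < y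
  FracAt-< {p = p} {q} {r} {s} x₀ {k} (fracAt fx) (fracAt fy) {cert} x₀≤k =
    Frac-< fx fy (subst₂ ℤ._<_ (eval-* p s (+ k)) (eval-* r q (+ k))
      (<-from x₀ (p *ₚ s) (r *ₚ q) (toWitness cert) x₀≤k))

  FracAt-≡ : ∀ {x y p q r s k} → FracAt x p q k → FracAt y r s k →
             {_ : True (all? (ℤ._≟ 0ℤ) (r *ₚ q -ₚ p *ₚ s))} → x ≡ y
  FracAt-≡ {p = p} {q} {r} {s} {k} (fracAt fx) (fracAt fy) {cert} =
    Frac-≡ fx fy (subst₂ _≡_ (eval-* p s k) (eval-* r q k)
      (≡-everywhere (p *ₚ s) (r *ₚ q) (toWitness cert) k))

  private
    fracZ : ℤ → ℤ → ℚ
    fracZ a (+ suc b) = a / suc b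
    fracZ a _         = 0ℚ

    Frac-fracZ : ∀ a {b} → 0ℤ ℤ.< b → Frac (fracZ a b) a b
    Frac-fracZ a {+ suc b} _         = Frac-/ a (suc b)
    Frac-fracZ a {+ zero}  (ℤ.+<+ ())

  -- p(k) / q(k), with junk value 0 when q(k) ≤ 0.  Opaque, since unfolding it at a symbolic k
  -- makes the type checker normalise p(k) and q(k) symbolically, which is prohibitively costly.
  opaque
    ratAt : Poly → Poly → ℕ → ℚ
    ratAt p q k = fracZ (⟦ p ⟧ (+ k)) (⟦ q ⟧ (+ k))

    FracAt-ratAt : ∀ p q {k} → 0ℤ ℤ.< ⟦ q ⟧ (+ k) → FracAt (ratAt p q k) p q (+ k)
    FracAt-ratAt p q q>0 = fracAt (Frac-fracZ _ q>0)

module PolynomialPart where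

  open import Data.Nat as ℕ using (ℕ)
  open import Data.Integer as ℤ using (ℤ; +_; 0ℤ)
  open import Data.List using (_∷_; [])
  open import Data.Rational using (_/_)
  open import Relation.Binary.PropositionalEquality
  open Polynomial
  open Fraction
  open RationalFunction

  polyPartNum : Poly
  polyPartNum = 0ℤ ∷ + 185 ∷ ℤ.- + 750 ∷ + 900 ∷ ℤ.- + 600 ∷ + 240 ∷ []

  P : ℕ → ℤ
  P n = ⟦ polyPartNum ⟧ (+ n)

  FracAt-nq : ∀ n → FracAt (nq n) xₚ (constₚ (+ 1)) (+ n)
  FracAt-nq n = fracAt (Frac-cong (sym (eval-x (+ n))) (sym (eval-const (+ 1) (+ n))) (Frac-/ (+ n) 1))

  FracAt-nq^ : ∀ d n → FracAt (nq (n ℕ.^ d)) (xₚ ^ₚ d) (constₚ (+ 1)) (+ n)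
  FracAt-nq^ d n =
    fracAt (Frac-cong (sym (eval-x^ d n)) (sym (eval-const (+ 1) (+ n))) (Frac-/ (+ (n ℕ.^ d)) 1))

  polyPart≡P/48 : ∀ n → polyPart n ≡ P n / 48
  polyPart≡P/48 n = FracAt-≡
    (FracAt-+ (FracAt-sub (FracAt-+ (FracAt-sub (FracAt-* (FracAt-const (+ 5) 1) (FracAt-nq^ 5 n))
                                            (FracAt-* (FracAt-const (+ 25) 2) (FracAt-nq^ 4 n)))
                                  (FracAt-* (FracAt-const (+ 75) 4) (FracAt-nq^ 3 n)))
                        (FracAt-* (FracAt-const (+ 125) 8) (FracAt-nq^ 2 n)))
              (FracAt-* (FracAt-const (+ 185) 48) (FracAt-nq n)))
    (FracAt-/ polyPartNum 48)

module TailBounds where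

  open import Data.Nat as ℕ using (ℕ; zero; suc; z≤n; s≤s)
  import Data.Nat.Properties as ℕ
  open import Data.Integer as ℤ using (ℤ; +_; 0ℤ; 1ℤ)
  import Data.Integer.Properties as ℤ
  open import Data.List using (_∷_; [])
  open import Data.Rational using (ℚ; _/_; _+_; _-_; _*_; _≤_; _<_; 0ℚ; 1ℚ; nonNegative)
  open import Data.Rational.Properties
  open import Data.Rational.Solver using (module +-*-Solver)
  open import Data.Product using (_,_)
  open import Relation.Binary.PropositionalEquality
  open import Relation.Nullary.Decidable using (toWitness)
  open Polynomial
  open Fraction
  open RationalFunction
  open PolynomialPart

  n₀ : ℕ
  n₀ = 829

  nonZero-from-n₀ : ∀ {n} → n₀ ℕ.≤ n → ℕ.NonZero n
  nonZero-from-n₀ n≥n₀ = ℕ.>-nonZero (ℕ.≤-trans (s≤s z≤n) n≥n₀)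

  -- lower k and upper k are, with y = 2k − 1, (96y⁶ − 480y⁴ + 3136y² − 29760)/(15y¹¹) and
  -- (96y⁸ − 480y⁶ + 3136y⁴ − 29760y² + 402336)/(15y¹³): in t = k − 1/2, the truncations
  -- 1/(5t⁵) − 1/(4t⁷) + 49/(120t⁹) − 31/(32t¹¹) (+ 4191/(1280t¹³)) of the midpoint
  -- Euler–Maclaurin expansion of Σ_{j≥k} j⁻⁶.
  lowerNum lowerDen upperNum upperDen : Poly
  lowerNum = ℤ.- + 27008 ∷ ℤ.- + 9856 ∷ + 6784 ∷ 0ℤ ∷ + 15360 ∷ ℤ.- + 18432 ∷ + 6144 ∷ []
  lowerDen = ℤ.- + 15 ∷ + 330 ∷ ℤ.- + 3300 ∷ + 19800 ∷ ℤ.- + 79200 ∷ + 221760 ∷ ℤ.- + 443520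
           ∷ + 633600 ∷ ℤ.- + 633600 ∷ + 422400 ∷ ℤ.- + 168960 ∷ + 30720 ∷ []
  upperNum = + 375328 ∷ + 98176 ∷ ℤ.- + 61824 ∷ ℤ.- + 66560 ∷ + 42496 ∷ ℤ.- + 79872 ∷ + 141312
           ∷ ℤ.- + 98304 ∷ + 24576 ∷ []
  upperDen = ℤ.- + 15 ∷ + 390 ∷ ℤ.- + 4680 ∷ + 34320 ∷ ℤ.- + 171600 ∷ + 617760 ∷ ℤ.- + 1647360
           ∷ + 3294720 ∷ ℤ.- + 4942080 ∷ + 5491200 ∷ ℤ.- + 4392960 ∷ + 2396160 ∷ ℤ.- + 798720
           ∷ + 122880 ∷ []

  lower upper : ℕ → ℚ
  lower = ratAt lowerNum lowerDen
  upper = ratAt upperNum upperDen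

  FracAt-lower : ∀ {k} → n₀ ℕ.≤ k → FracAt (lower k) lowerNum lowerDen (+ k)
  FracAt-lower k≥n₀ = FracAt-ratAt lowerNum lowerDen (pos-from n₀ lowerDen k≥n₀)

  FracAt-upper : ∀ {k} → n₀ ℕ.≤ k → FracAt (upper k) upperNum upperDen (+ k)
  FracAt-upper k≥n₀ = FracAt-ratAt upperNum upperDen (pos-from n₀ upperDen k≥n₀)

  FracAt-recip6 : ∀ j → FracAt (recip6 (suc j)) (constₚ 1ℤ) (xₚ ^ₚ 6) (+ suc j)
  FracAt-recip6 j = fracAt
    (Frac-cong (sym (eval-const 1ℤ (+ suc j))) (sym (eval-x^ 6 (suc j))) (Frac-/ (+ 1) (suc j ℕ.^ 6)))

  FracAt-next : ∀ {x p q k} → FracAt x p q (+ suc k) →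
                FracAt x (p ∘ₚ (constₚ 1ℤ +ₚ xₚ)) (q ∘ₚ (constₚ 1ℤ +ₚ xₚ)) (+ k)
  FracAt-next {k = k} = FracAt-∘ (constₚ 1ℤ +ₚ xₚ) (eval-shift 1 k)

  recip6≤upper-step : ∀ {k} → n₀ ℕ.≤ k → recip6 k ≤ upper k - upper (suc k)
  recip6≤upper-step {suc j} k≥n₀ = FracAt-≤ n₀ (FracAt-recip6 j)
    (FracAt-sub (FracAt-upper k≥n₀) (FracAt-next (FracAt-upper (ℕ.m≤n⇒m≤1+n k≥n₀)))) k≥n₀

  lower-step≤recip6 : ∀ {k} → n₀ ℕ.≤ k → lower k - lower (suc k) ≤ recip6 k
  lower-step≤recip6 {suc j} k≥n₀ = FracAt-≤ n₀
    (FracAt-sub (FracAt-lower k≥n₀) (FracAt-next (FracAt-lower (ℕ.m≤n⇒m≤1+n k≥n₀))))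
    (FracAt-recip6 j) k≥n₀

  module _ (f : ℕ → ℚ) {n : ℕ} where
    open +-*-Solver

    private
      telescope : ∀ a b c → (a - b) + (b - c) ≡ a - c
      telescope = solve 3 (λ a b c → (a :- b) :+ (b :- c) := a :- c) refl

      step-≡ : ∀ N → f n - f (suc (n ℕ.+ N)) + (f (n ℕ.+ suc N) - f (suc (n ℕ.+ suc N)))
                   ≡ f n - f (suc (n ℕ.+ suc N))
      step-≡ N = trans
        (cong (λ m → f n - f m + (f (n ℕ.+ suc N) - f (suc (n ℕ.+ suc N)))) (sym (ℕ.+-suc n N)))
        (telescope (f n) (f (n ℕ.+ suc N)) (f (suc (n ℕ.+ suc N))))

    tail≤telescope : (∀ {k} → n ℕ.≤ k → recip6 k ≤ f k - f (suc k)) →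
                     ∀ N → tailPartial n N ≤ f n - f (suc (n ℕ.+ N))
    tail≤telescope step zero rewrite ℕ.+-identityʳ n = step ℕ.≤-refl
    tail≤telescope step (suc N) = subst (tailPartial n (suc N) ≤_) (step-≡ N)
      (+-mono-≤ (tail≤telescope step N) (step (ℕ.m≤m+n n (suc N))))

    telescope≤tail : (∀ {k} → n ℕ.≤ k → f k - f (suc k) ≤ recip6 k) →
                     ∀ N → f n - f (suc (n ℕ.+ N)) ≤ tailPartial n N
    telescope≤tail step zero rewrite ℕ.+-identityʳ n = step ℕ.≤-refl
    telescope≤tail step (suc N) = subst (_≤ tailPartial n (suc N)) (step-≡ N)
      (+-mono-≤ (telescope≤tail step N) (step (ℕ.m≤m+n n (suc N))))

  recip6-nonNeg : ∀ k → 0ℚ ≤ recip6 k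
  recip6-nonNeg zero    = ≤-refl
  recip6-nonNeg (suc j) = Frac-≤ (Frac-/ 0ℤ 1) (Frac-/ (+ 1) (suc j ℕ.^ 6)) (ℤ.+≤+ z≤n)

  tail-nonNeg : ∀ n N → 0ℚ ≤ tailPartial n N
  tail-nonNeg n zero    = recip6-nonNeg n
  tail-nonNeg n (suc N) = +-mono-≤ (tail-nonNeg n N) (recip6-nonNeg (n ℕ.+ suc N))

  p-q≤p : ∀ p {q} → 0ℚ ≤ q → p - q ≤ p
  p-q≤p p q≥0 = subst (p - _ ≤_) (+-identityʳ p) (+-monoʳ-≤ p (neg-antimono-≤ q≥0))

  upper-nonNeg : ∀ {k} → n₀ ℕ.≤ k → 0ℚ ≤ upper k
  upper-nonNeg k≥n₀ = FracAt-≤ n₀ (FracAt-const 0ℤ 1) (FracAt-upper k≥n₀) k≥n₀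

  tail≤upper : ∀ {n} → n₀ ℕ.≤ n → ∀ N → tailPartial n N ≤ upper n
  tail≤upper {n} n≥n₀ N = ≤-trans
    (tail≤telescope upper (λ k≥n → recip6≤upper-step (ℕ.≤-trans n≥n₀ k≥n)) N)
    (p-q≤p (upper n) (upper-nonNeg (ℕ.≤-trans n≥n₀ (ℕ.m≤n⇒m≤1+n (ℕ.m≤m+n n N)))))

  recipPow : ℕ → ℕ → ℚ
  recipPow d = ratAt (constₚ 1ℤ) (xₚ ^ₚ d)

  FracAt-recipPow : ∀ d k .{{_ : ℕ.NonZero k}} → FracAt (recipPow d k) (constₚ 1ℤ) (xₚ ^ₚ d) (+ k)
  FracAt-recipPow d k = FracAt-ratAt (constₚ 1ℤ) (xₚ ^ₚ d)
    (subst (0ℤ ℤ.<_) (sym (eval-x^ d k)) (ℤ.+<+ (ℕ.m^n>0 k d)))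

  recipPow-≤ : ∀ m d k d′ .{{_ : ℕ.NonZero m}} .{{_ : ℕ.NonZero k}} →
               m ℕ.^ d ℕ.≤ k ℕ.^ d′ → recipPow d′ k ≤ recipPow d m
  recipPow-≤ m d k d′ mᵈ≤kᵈ′ =
    Frac-≤ (frac-at (FracAt-recipPow d′ k)) (frac-at (FracAt-recipPow d m)) (subst₂ ℤ._≤_
      (sym (cong₂ ℤ._*_ (eval-const 1ℤ (+ k)) (eval-x^ d m)))
      (sym (cong₂ ℤ._*_ (eval-const 1ℤ (+ m)) (eval-x^ d′ k)))
      (subst₂ ℤ._≤_ (sym (ℤ.*-identityˡ _)) (sym (ℤ.*-identityˡ _)) (ℤ.+≤+ mᵈ≤kᵈ′)))

  lower≤recip5 : ∀ {k} .{{_ : ℕ.NonZero k}} → n₀ ℕ.≤ k → lower k ≤ recipPow 5 k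
  lower≤recip5 {k} k≥n₀ = FracAt-≤ n₀ (FracAt-lower k≥n₀) (FracAt-recipPow 5 k) k≥n₀

  lower-recip15≤tail : ∀ {n} → n₀ ℕ.≤ n → lower n - recipPow 15 n ≤ tailPartial n (n ℕ.^ 3)
  lower-recip15≤tail {n} n≥n₀ = begin
    lower n - recipPow 15 n  ≤⟨ +-monoʳ-≤ (lower n) (neg-antimono-≤ lowerₑ≤recip15) ⟩
    lower n - lower e        ≤⟨ telescope≤tail lower (λ k≥n → lower-step≤recip6 (ℕ.≤-trans n≥n₀ k≥n))
                                  (n ℕ.^ 3) ⟩
    tailPartial n (n ℕ.^ 3)  ∎
    where
    open ≤-Reasoning
    instance
      n≢0 : ℕ.NonZero n
      n≢0 = nonZero-from-n₀ n≥n₀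
    e : ℕ
    e = suc (n ℕ.+ n ℕ.^ 3)
    e≥n₀ : n₀ ℕ.≤ e
    e≥n₀ = ℕ.≤-trans n≥n₀ (ℕ.≤-trans (ℕ.m≤m+n n _) (ℕ.n≤1+n _))
    n¹⁵≤e⁵ : n ℕ.^ 15 ℕ.≤ e ℕ.^ 5
    n¹⁵≤e⁵ = subst (ℕ._≤ e ℕ.^ 5) (ℕ.^-*-assoc n 3 5)
      (ℕ.^-monoˡ-≤ 5 (ℕ.≤-trans (ℕ.m≤n+m (n ℕ.^ 3) n) (ℕ.n≤1+n _)))
    lowerₑ≤recip15 : lower e ≤ recipPow 15 n
    lowerₑ≤recip15 = ≤-trans (lower≤recip5 e≥n₀) (recipPow-≤ n 15 e 5 n¹⁵≤e⁵)

  shiftedPart : ℤ → ℕ → ℚ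
  shiftedPart c n = (P n ℤ.+ c) / 48

  FracAt-shiftedPart : ∀ c n →
                       FracAt (shiftedPart c n) (polyPartNum +ₚ constₚ c) (constₚ (+ 48)) (+ n)
  FracAt-shiftedPart c n = fracAt (Frac-cong
    (sym (trans (eval-+ polyPartNum (constₚ c) (+ n)) (cong (λ v → P n ℤ.+ v) (eval-const c (+ n)))))
    (sym (eval-const (+ 48) (+ n))) (Frac-/ (P n ℤ.+ c) 48))

  P-nonNeg : ∀ {n} → n₀ ℕ.≤ n → 0ℤ ℤ.≤ P n
  P-nonNeg = nonNegFrom⇒nonNeg polyPartNum (toWitness {a? = nonNegFrom? n₀ polyPartNum} _)

  shiftedPart-nonNeg : ∀ {c n} → n₀ ℕ.≤ n → 0ℤ ℤ.≤ c → 0ℚ ≤ shiftedPart c n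
  shiftedPart-nonNeg {c} {n} n≥n₀ c≥0 = Frac-≤ (Frac-/ 0ℤ 1) (Frac-/ (P n ℤ.+ c) 48)
    (subst (0ℤ ℤ.≤_) (sym (ℤ.*-identityʳ _)) (ℤ.+-mono-≤ (P-nonNeg n≥n₀) c≥0))

  shiftedPart*upper≤1 : ∀ {n} → n₀ ℕ.≤ n → shiftedPart (+ 12) n * upper n ≤ 1ℚ
  shiftedPart*upper≤1 {n} n≥n₀ =
    FracAt-≤ n₀ (FracAt-* (FracAt-shiftedPart (+ 12) n) (FracAt-upper n≥n₀)) (FracAt-const 1ℤ 1) n≥n₀

  1<shiftedPart*lower : ∀ {n} → n₀ ℕ.≤ n → 1ℚ < shiftedPart (+ 13) n * (lower n - recipPow 15 n)
  1<shiftedPart*lower {n} n≥n₀ = FracAt-< n₀ (FracAt-const 1ℤ 1)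
    (FracAt-* (FracAt-shiftedPart (+ 13) n)
              (FracAt-sub (FracAt-lower n≥n₀) (FracAt-recipPow 15 n {{nonZero-from-n₀ n≥n₀}}))) n≥n₀

  module _ {n : ℕ} (m : ℤ) (n≥n₀ : n₀ ℕ.≤ n) where
    open ≤-Reasoning

    m*tail≤1 : m ℤ.* + 48 ℤ.≤ P n ℤ.+ + 12 → ∀ N → fromℤ m * tailPartial n N ≤ 1ℚ
    m*tail≤1 48m≤P+12 N = begin
      fromℤ m * S      ≤⟨ *-monoʳ-≤-nonNeg S {{nonNegative (tail-nonNeg n N)}} m≤bound ⟩
      bound * S        ≤⟨ *-monoˡ-≤-nonNeg bound {{nonNegative bound≥0}} (tail≤upper n≥n₀ N) ⟩
      bound * upper n  ≤⟨ shiftedPart*upper≤1 n≥n₀ ⟩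
      1ℚ               ∎
      where
      S bound : ℚ
      S     = tailPartial n N
      bound = shiftedPart (+ 12) n
      bound≥0 : 0ℚ ≤ bound
      bound≥0 = shiftedPart-nonNeg n≥n₀ (ℤ.+≤+ z≤n)
      m≤bound : fromℤ m ≤ bound
      m≤bound = Frac-≤ (Frac-/ m 1) (Frac-/ (P n ℤ.+ + 12) 48)
        (subst (m ℤ.* + 48 ℤ.≤_) (sym (ℤ.*-identityʳ _)) 48m≤P+12)

    1<[m+1]*tail : P n ℤ.+ + 13 ℤ.≤ (m ℤ.+ 1ℤ) ℤ.* + 48 →
                   1ℚ < (fromℤ m + 1ℚ) * tailPartial n (n ℕ.^ 3)
    1<[m+1]*tail P+13≤48[m+1] = begin-strict
      1ℚ                                 <⟨ 1<shiftedPart*lower n≥n₀ ⟩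
      bound * (lower n - recipPow 15 n)  ≤⟨ *-monoˡ-≤-nonNeg bound {{nonNegative bound≥0}}
                                              (lower-recip15≤tail n≥n₀) ⟩
      bound * S                          ≤⟨ *-monoʳ-≤-nonNeg S {{nonNegative (tail-nonNeg n (n ℕ.^ 3))}}
                                              bound≤m+1 ⟩
      (fromℤ m + 1ℚ) * S                 ∎
      where
      S bound : ℚ
      S     = tailPartial n (n ℕ.^ 3)
      bound = shiftedPart (+ 13) n
      bound≥0 : 0ℚ ≤ bound
      bound≥0 = shiftedPart-nonNeg n≥n₀ (ℤ.+≤+ z≤n)
      bound≤m+1 : bound ≤ fromℤ m + 1ℚ
      bound≤m+1 = Frac-≤ (Frac-/ (P n ℤ.+ + 13) 48) (Frac-+ (Frac-/ m 1) (Frac-/ 1ℤ 1))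
        (subst₂ ℤ._≤_ (sym (ℤ.*-identityʳ _)) (cong (λ v → (v ℤ.+ 1ℤ) ℤ.* + 48) (sym (ℤ.*-identityʳ m)))
          P+13≤48[m+1])

    isFloorRecipTail : m ℤ.* + 48 ℤ.≤ P n ℤ.+ + 12 → P n ℤ.+ + 13 ℤ.≤ (m ℤ.+ 1ℤ) ℤ.* + 48 →
                       IsFloorRecipTail n m
    isFloorRecipTail lo hi = m*tail≤1 lo , (n ℕ.^ 3 , 1<[m+1]*tail hi)

module Residues where

  open import Data.Nat as ℕ using (ℕ; _%_; _/_)
  open import Data.Nat.DivMod using (m≡m%n+[m/n]*n; m%n<n; m∣n⇒o%n%m≡o%m)
  open import Data.Nat.Divisibility as ℕ∣ using (m%n≡0⇒n∣m; n∣m⇒m%n≡0; _∣?_)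
  open import Data.Integer as ℤ using (ℤ; +_; 1ℤ)
  import Data.Integer.Properties as ℤ
  open import Data.Integer.Divisibility.Signed as ℤ∣ using (divides; ∣m∣n⇒∣m+n)
  open import Data.Integer.Tactic.RingSolver using (solve-∀)
  open import Data.Fin using (Fin; toℕ; fromℕ<)
  open import Data.Fin.Properties using (all?; toℕ-fromℕ<)
  open import Data.Rational as ℚ using (ℚ; floor)
  open import Data.Bool using (if_then_else_)
  open import Data.Product using (_×_; proj₁)
  open import Relation.Nullary using (¬_; does)
  open import Relation.Nullary.Decidable using (toWitness; _×-dec_; dec-true; dec-false)
  open import Relation.Binary.PropositionalEquality
  open Polynomial
  open Fraction
  open PolynomialPart

  offsetEven offsetOdd : ℕ → ℤ
  offsetEven r = + (5 ℕ.* r) ℤ.+ + 48 ℤ.* floor ((+ 35 ℤ.- + (5 ℕ.* r)) ℚ./ 48)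
  offsetOdd  r = + (5 ℕ.* r ℕ.+ 18) ℤ.+ + 48 ℤ.* floor ((+ 17 ℤ.- + (5 ℕ.* r)) ℚ./ 48)

  -- In the paper's formula, f(n) = polyPart n − offset (n mod 48) / 48.
  offset : ℕ → ℤ
  offset r = if does (2 ∣? r) then offsetEven r else offsetOdd r

  offset-even : ∀ {r} → 2 ℕ∣.∣ r → offset r ≡ offsetEven r
  offset-even {r} 2∣r rewrite dec-true (2 ∣? r) 2∣r = refl

  offset-odd : ∀ {r} → ¬ 2 ℕ∣.∣ r → offset r ≡ offsetOdd r
  offset-odd {r} 2∤r rewrite dec-false (2 ∣? r) 2∤r = refl

  OffsetFacts : ℕ → Set
  OffsetFacts r = (+ 48 ℤ∣.∣ P r ℤ.- offset r) × (ℤ.- + 12 ℤ.≤ offset r) × (offset r ℤ.≤ + 35)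

  offsetFacts : ∀ r → r ℕ.< 48 → OffsetFacts r
  offsetFacts r r<48 = subst OffsetFacts (toℕ-fromℕ< r<48) (allResidues (fromℕ< r<48))
    where
    allResidues : ∀ (i : Fin 48) → OffsetFacts (toℕ i)
    allResidues = toWitness {a? = all? (λ i → (+ 48 ℤ∣.∣? _) ×-dec (_ ℤ.≤? _) ×-dec (_ ℤ.≤? _))} _

  P-mod-48 : ∀ n → + 48 ℤ∣.∣ P n ℤ.- P (n % 48)
  P-mod-48 n = eval-∣ polyPartNum (+ n) (+ r) (divides (+ q) n-r≡)
    where
    r q : ℕ
    r = n % 48
    q = n / 48
    n-r≡ : + n ℤ.- + r ≡ + q ℤ.* + 48
    n-r≡ = begin
      + n ℤ.- + r                        ≡⟨ cong (λ k → + k ℤ.- + r) (m≡m%n+[m/n]*n n 48) ⟩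
      + (r ℕ.+ q ℕ.* 48) ℤ.- + r         ≡⟨ cong (ℤ._- + r) (ℤ.pos-+ r (q ℕ.* 48)) ⟩
      + r ℤ.+ + (q ℕ.* 48) ℤ.- + r       ≡⟨ cong (λ v → + r ℤ.+ v ℤ.- + r) (ℤ.pos-* q 48) ⟩
      + r ℤ.+ + q ℤ.* + 48 ℤ.- + r       ≡⟨ cancel (+ r) (+ q ℤ.* + 48) ⟩
      + q ℤ.* + 48                       ∎
      where
      open ≡-Reasoning
      cancel : ∀ a b → a ℤ.+ b ℤ.- a ≡ b
      cancel = solve-∀

  P-offset-congruence : ∀ n → + 48 ℤ∣.∣ P n ℤ.- offset (n % 48)
  P-offset-congruence n = subst (+ 48 ℤ∣.∣_) (telescope (P n) (P (n % 48)) (offset (n % 48)))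
    (∣m∣n⇒∣m+n (P-mod-48 n) (proj₁ (offsetFacts (n % 48) (m%n<n n 48))))
    where
    telescope : ∀ a b c → a ℤ.- b ℤ.+ (b ℤ.- c) ≡ a ℤ.- c
    telescope = solve-∀

  n%48%2≡n%2 : ∀ n → n % 48 % 2 ≡ n % 2
  n%48%2≡n%2 n = m∣n⇒o%n%m≡o%m 2 48 n (ℕ∣.divides 24 refl)

  even⇒even-%48 : ∀ {n} → 2 ℕ∣.∣ n → 2 ℕ∣.∣ n % 48
  even⇒even-%48 {n} 2∣n = m%n≡0⇒n∣m (n % 48) 2 (trans (n%48%2≡n%2 n) (n∣m⇒m%n≡0 n 2 2∣n))

  odd⇒odd-%48 : ∀ {n} → ¬ 2 ℕ∣.∣ n → ¬ 2 ℕ∣.∣ n % 48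
  odd⇒odd-%48 {n} 2∤n 2∣r =
    2∤n (m%n≡0⇒n∣m n 2 (trans (sym (n%48%2≡n%2 n)) (n∣m⇒m%n≡0 (n % 48) 2 2∣r)))

  module _ (p c m : ℤ) (p-c≡m*48 : p ℤ.- c ≡ m ℤ.* + 48) where

    quotient-lower : ℤ.- + 12 ℤ.≤ c → m ℤ.* + 48 ℤ.≤ p ℤ.+ + 12
    quotient-lower c≥-12 = subst (ℤ._≤ p ℤ.+ + 12) p-c≡m*48 (ℤ.+-monoʳ-≤ p (ℤ.neg-mono-≤ c≥-12))

    quotient-upper : c ℤ.≤ + 35 → p ℤ.+ + 13 ℤ.≤ (m ℤ.+ 1ℤ) ℤ.* + 48
    quotient-upper c≤35 = subst₂ ℤ._≤_
      (shift p) (trans (cong (ℤ._+ + 48) p-c≡m*48) (sym (ℤ.*-distribʳ-+ (+ 48) m 1ℤ)))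
      (ℤ.+-monoˡ-≤ (+ 48) (ℤ.+-monoʳ-≤ p (ℤ.neg-mono-≤ c≤35)))
      where
      shift : ∀ p → p ℤ.- + 35 ℤ.+ + 48 ≡ p ℤ.+ + 13
      shift = solve-∀

  quotient≡formula : ∀ n m R F → P n ℤ.- (R ℤ.+ + 48 ℤ.* F) ≡ m ℤ.* + 48 →
                     fromℤ m ≡ polyPart n ℚ.- R ℚ./ 48 ℚ.- fromℤ F
  quotient≡formula n m R F P-c≡m*48 = begin
    fromℤ m                              ≡⟨ Frac-≡ (Frac-/ m 1) (Frac-sub (Frac-sub (Frac-/ (P n) 48) (Frac-/ R 48))
                                                                      (Frac-/ F 1)) cross ⟩
    P n ℚ./ 48 ℚ.- R ℚ./ 48 ℚ.- fromℤ F  ≡⟨ cong (λ x → x ℚ.- R ℚ./ 48 ℚ.- fromℤ F) (polyPart≡P/48 n) ⟨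
    polyPart n ℚ.- R ℚ./ 48 ℚ.- fromℤ F  ∎
    where
    open ≡-Reasoning
    scale : ∀ m → m ℤ.* (+ 48 ℤ.* + 48 ℤ.* + 1) ≡ m ℤ.* + 48 ℤ.* + 48
    scale = solve-∀
    expand : ∀ p R F → (p ℤ.- (R ℤ.+ + 48 ℤ.* F)) ℤ.* + 48
                     ≡ ((p ℤ.* + 48 ℤ.- R ℤ.* + 48) ℤ.* + 1 ℤ.- F ℤ.* (+ 48 ℤ.* + 48)) ℤ.* + 1
    expand = solve-∀
    cross : m ℤ.* (+ 48 ℤ.* + 48 ℤ.* + 1)
          ≡ ((P n ℤ.* + 48 ℤ.- R ℤ.* + 48) ℤ.* + 1 ℤ.- F ℤ.* (+ 48 ℤ.* + 48)) ℤ.* + 1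
    cross = trans (scale m) (trans (cong (ℤ._* + 48) (sym P-c≡m*48)) (expand (P n) R F))

  formula-even : ∀ n m → P n ℤ.- offset (n % 48) ≡ m ℤ.* + 48 →
                 2 ℕ∣.∣ n → fromℤ m ≡ formulaEven n
  formula-even n m P-c≡m*48 2∣n =
    quotient≡formula n m (+ (5 ℕ.* r)) (floor ((+ 35 ℤ.- + (5 ℕ.* r)) ℚ./ 48))
      (subst (λ c → P n ℤ.- c ≡ m ℤ.* + 48) (offset-even (even⇒even-%48 2∣n)) P-c≡m*48)
    where
    r : ℕ
    r = n % 48

  formula-odd : ∀ n m → P n ℤ.- offset (n % 48) ≡ m ℤ.* + 48 →
                ¬ 2 ℕ∣.∣ n → fromℤ m ≡ formulaOdd n
  formula-odd n m P-c≡m*48 2∤n =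
    quotient≡formula n m (+ (5 ℕ.* r ℕ.+ 18)) (floor ((+ 17 ℤ.- + (5 ℕ.* r)) ℚ./ 48))
      (subst (λ c → P n ℤ.- c ≡ m ℤ.* + 48) (offset-odd (odd⇒odd-%48 2∤n)) P-c≡m*48)
    where
    r : ℕ
    r = n % 48

open import Data.Nat using (ℕ; _≤_; _%_)
open import Data.Nat.DivMod using (m%n<n)
open import Data.Nat.Divisibility using (_∣_)
open import Data.Integer using (ℤ)
open import Data.Integer.Divisibility.Signed using (divides)
open import Data.Product using (Σ; _×_; _,_)
open import Relation.Nullary using (¬_)
open import Relation.Binary.PropositionalEquality using (_≡_)
open PolynomialPart using (P)
open TailBounds using (isFloorRecipTail)
open Residues

theorem2p1 : (n : ℕ) → 829 ≤ n →
    Σ ℤ (λ m → IsFloorRecipTail n m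
    × ((2 ∣ n → fromℤ m ≡ formulaEven n)
    × (¬ (2 ∣ n) → fromℤ m ≡ formulaOdd n)))
theorem2p1 n n≥829 =
  let divides m P-c≡m*48 = P-offset-congruence n
      _ , c≥-12 , c≤35   = offsetFacts (n % 48) (m%n<n n 48)
      c                  = offset (n % 48)
  in m , isFloorRecipTail m n≥829 (quotient-lower (P n) c m P-c≡m*48 c≥-12)
                                  (quotient-upper (P n) c m P-c≡m*48 c≤35)
       , formula-even n m P-c≡m*48 , formula-odd n m P-c≡m*48
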